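{- Let $(X,Y,\phi)$ be an $L$-context, $X'\subseteq X$, $Y'\subseteq Y$, with inclusions $\tau\colon X'\to X$ and $\nu\colon Y'\to Y$. Then: (1) $\mathcal K\phi_{X,Y'}\subseteq\mathcal K\phi$, and $\mathcal K(1_X,\nu)^*\colon\mathcal K\phi_{X,Y'}\to\mathcal K\phi$ is the inclusion map; (2) $\mathcal K(\tau,1_Y)\colon\mathcal K\phi_{X',Y}\to\mathcal K\phi$ is $L$-isometric, and $\mathcal K(\tau,1_Y)^*\colon\mathcal K\phi\to\mathcal K\phi_{X',Y}$ is the restriction map $\mu\mapsto\mu_{X'}$.
   Context: $L=(L,*)$ is a complete residuated lattice: a complete lattice with bottom $0$ and top $1$ with a commutative monoid operation $*$ with unit $1$ satisfying $a*\bigvee_i b_i=\bigvee_i a*b_i$; $\rightarrow$ is its residuum ($a*b\le c\iff a\le b\rightarrow c$). An $L$-context is $(X,Y,\phi)$ with $\phi\colon X\times Y\to L$. $L^X$ is the set of maps $X\to L$ with $L$-order $L^X(\mu,\mu')=\bigwedge_x\mu(x)\rightarrow\mu'(x)$, inherited by subsets. Define $\phi^\exists(\mu)(y)=\bigvee_x\mu(x)*\phi(x,y)$, $\phi^\forall(\lambda)(x)=\bigwedge_y\phi(x,y)\rightarrow\lambda(y)$, and $\mathcal K\phi=\{\mu\in L^X:\phi^\forall\phi^\exists\mu=\mu\}$. $\phi_{A,B}$ is the restriction of $\phi$ to $A\times B$; $\mu_{X'}$ is the restriction of $\mu$ to $X'$. An infomorphism $(f,g)\colon(X,Y,\phi)\to(A,B,\psi)$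 is a pair of maps $f\colon X\to A$, $g\colon B\to Y$ with $\phi(x,gb)=\psi(fx,b)$ for all $x,b$; it induces $\mathcal K(f,g)\colon\mathcal K\phi\to\mathcal K\psi$, $\mu\mapsto\psi^\forall\psi^\exists f^{\rightarrow}\mu$, where $(f^{\rightarrow}\mu)(a)=\bigvee_{fx=a}\mu(x)$, and $\mathcal K(f,g)^*\colon\mathcal K\psi\to\mathcal K\phi$, $\lambda\mapsto\lambda\circ f$ (it is known these are well defined and $\mathcal K(f,g)\dashv\mathcal K(f,g)^*$). In particular $(1_X,\nu)\colon(X,Y,\phi)\to(X,Y',\phi_{X,Y'})$ and $(\tau,1_Y)\colon(X',Y,\phi_{X',Y})\to(X,Y,\phi)$ are infomorphisms. A map $h\colon P\to Q$ with $P\subseteq L^{A}$, $Q\subseteq L^{B}$ is $L$-isometric if $L^A(p,p')=L^B(hp,hp')$ for all $p,p'\in P$. -}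

module Defs where

open import Level using (Level; _⊔_) renaming (suc to lsuc)
open import Data.Product using (Σ; _,_; proj₁; proj₂; _×_)
open import Function using (_∘_; id)
open import Relation.Binary.PropositionalEquality using (_≡_)
open import Relation.Binary.Structures using (IsPartialOrder)
open import Algebra.Structures using (IsCommutativeMonoid)

-- Equality on the carrier is propositional
-- equality; arbitrary joins/meets are over index types in the universe Set ι
-- (the universe in which the contexts' object/attribute sets live).
record CompleteResiduatedLattice (c ℓ ι : Level) : Set (lsuc (c ⊔ ℓ ⊔ ι)) where
  infixl 7 _*_
  infixr 5 _⇒_
  infix 4 _≤_
  field
    Carrier        : Set c
    _≤_            : Carrier → Carrier → Set ℓ
    isPartialOrder : IsPartialOrder _≡_ _≤_
    ⋁              : {I : Set ι} → (I → Carrier) → Carrier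
    ⋁-upper        : {I : Set ι} (f : I → Carrier) (i : I) → f i ≤ ⋁ f
    ⋁-least        : {I : Set ι} (f : I → Carrier) (a : Carrier) → (∀ i → f i ≤ a) → ⋁ f ≤ a
    ⋀              : {I : Set ι} → (I → Carrier) → Carrier
    ⋀-lower        : {I : Set ι} (f : I → Carrier) (i : I) → ⋀ f ≤ f i
    ⋀-greatest     : {I : Set ι} (f : I → Carrier) (a : Carrier) → (∀ i → a ≤ f i) → a ≤ ⋀ f
    0#             : Carrier
    1#             : Carrier
    0-least        : ∀ a → 0# ≤ a
    1-greatest     : ∀ a → a ≤ 1#
    _*_            : Carrier → Carrier → Carrier
    isCommutativeMonoid : IsCommutativeMonoid _≡_ _*_ 1#
    *-distrib-⋁    : {I : Set ι} (a : Carrier) (f : I → Carrier) → a * ⋁ f ≡ ⋁ (λ i → a * f i)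
    _⇒_            : Carrier → Carrier → Carrier
    residuated     : ∀ a b c → (a * b ≤ c → a ≤ b ⇒ c) × (a ≤ b ⇒ c → a * b ≤ c)

module _ {c ℓ ι : Level} (L : CompleteResiduatedLattice c ℓ ι) where
  open CompleteResiduatedLattice L

  L^ : Set ι → Set (c ⊔ ι)
  L^ A = A → Carrier

  L-ord : {A : Set ι} → L^ A → L^ A → Carrier
  L-ord μ μ' = ⋀ (λ x → μ x ⇒ μ' x)

  _^∃ : {X Y : Set ι} → (X → Y → Carrier) → L^ X → L^ Y
  (φ ^∃) μ y = ⋁ (λ x → μ x * φ x y)

  _^∀ : {X Y : Set ι} → (X → Y → Carrier) → L^ Y → L^ X
  (φ ^∀) λ' x = ⋀ (λ y → φ x y ⇒ λ' y)

  _∈𝒦_ : {X Y : Set ι} → L^ X → (X → Y → Carrier) → Set (c ⊔ ι)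
  μ ∈𝒦 φ = ∀ x → (φ ^∀) ((φ ^∃) μ) x ≡ μ x

  _^→ : {X A : Set ι} → (X → A) → L^ X → L^ A
  (f ^→) μ a = ⋁ {Σ _ (λ x → f x ≡ a)} (λ p → μ (proj₁ p))

  -- the maps induced by an infomorphism (f,g) : (X,Y,φ) → (A,B,ψ)
  -- 𝒦(f,g) μ = ψ^∀ ψ^∃ f^→ μ   and   𝒦(f,g)^* λ = λ ∘ f
  𝒦map : {X A B : Set ι} (ψ : A → B → Carrier) (f : X → A) → L^ X → L^ A
  𝒦map ψ f μ = (ψ ^∀) ((ψ ^∃) ((f ^→) μ))

  𝒦star : {X A : Set ι} (f : X → A) → L^ A → L^ X
  𝒦star f λ' = λ' ∘ f

-- subsets of X as subtypes given by a proposition-valued predicate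
IsProp-valued : {ι : Level} {X : Set ι} → (X → Set ι) → Set ι
IsProp-valued P = ∀ x (p q : P x) → p ≡ q

Sub : {ι : Level} (X : Set ι) → (X → Set ι) → Set ι
Sub X P = Σ X P

restrict : {ℓ ι : Level} {C : Set ℓ} {X Y : Set ι} {P : X → Set ι} {Q : Y → Set ι}
         → (X → Y → C) → Sub X P → Sub Y Q → C
restrict φ a b = φ (proj₁ a) (proj₁ b)

restrictʳ : {ℓ ι : Level} {C : Set ℓ} {X Y : Set ι} {Q : Y → Set ι}
          → (X → Y → C) → X → Sub Y Q → C
restrictʳ φ x b = φ x (proj₁ b)

restrictˡ : {ℓ ι : Level} {C : Set ℓ} {X Y : Set ι} {P : X → Set ι}
          → (X → Y → C) → Sub X P → Y → C
restrictˡ φ a y = φ (proj₁ a) y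

{-# OPTIONS --safe #-}
module Submission where

-- Restricting the attributes along g only drops meetands from φ^∀, so φ^∀φ^∃μ
-- lies below the closure of μ in the restricted context, which is μ itself.
-- Restricting the objects along f, one has φ^∃(f^→μ) = (φ∘f)^∃μ, so 𝒦(f,1)μ
-- agrees with μ on the image of f whenever μ is closed; hence
-- 𝒦(f,1)^* ∘ 𝒦(f,1) = id, which together with the L-monotonicity of φ^∃ and
-- φ^∀ makes 𝒦(f,1) isometric.

open import Defs
open import Level using (Level)
open import Data.Product using (_,_; proj₁; proj₂; _×_)
open import Function using (id; _∘_)
open import Relation.Binary.PropositionalEquality
  using (_≡_; _≗_; refl; sym; trans; cong; cong₂)
open import Relation.Binary.Bundles using (Poset)
open import Relation.Binary.Structures using (IsPartialOrder)
open import Algebra.Structures using (IsCommutativeMonoid)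

module _ {c ℓ ι : Level} (L : CompleteResiduatedLattice c ℓ ι) where
  open CompleteResiduatedLattice L
  open IsPartialOrder isPartialOrder
    using (antisym) renaming (refl to ≤-refl; trans to ≤-trans; reflexive to ≤-reflexive)
  open IsCommutativeMonoid isCommutativeMonoid using (assoc; comm)

  private
    variable
      a b d : Carrier
      I J X X′ Y Y′ : Set ι

  poset : Poset c c ℓ
  poset = record { isPartialOrder = isPartialOrder }

  open import Relation.Binary.Reasoning.PartialOrder poset

  ⇒-intro : a * b ≤ d → a ≤ b ⇒ d
  ⇒-intro = proj₁ (residuated _ _ _)

  ⇒-elim : a ≤ b ⇒ d → a * b ≤ d
  ⇒-elim = proj₂ (residuated _ _ _)

  ⇒-eval : (a ⇒ b) * a ≤ b
  ⇒-eval = ⇒-elim ≤-refl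

  *-monoˡ-≤ : ∀ d → a ≤ b → a * d ≤ b * d
  *-monoˡ-≤ d a≤b = ⇒-elim (≤-trans a≤b (⇒-intro ≤-refl))

  *-monoʳ-≤ : ∀ d → a ≤ b → d * a ≤ d * b
  *-monoʳ-≤ {a} {b} d a≤b = begin
    d * a ≡⟨ comm d a ⟩
    a * d ≤⟨ *-monoˡ-≤ d a≤b ⟩
    b * d ≡⟨ comm b d ⟩
    d * b ∎

  ⇒-monoʳ-≤ : ∀ d → a ≤ b → d ⇒ a ≤ d ⇒ b
  ⇒-monoʳ-≤ d a≤b = ⇒-intro (≤-trans ⇒-eval a≤b)

  ⋁-mono : {f g : I → Carrier} → (∀ i → f i ≤ g i) → ⋁ f ≤ ⋁ g
  ⋁-mono {f = f} {g} f≤g = ⋁-least f (⋁ g) (λ i → ≤-trans (f≤g i) (⋁-upper g i))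

  ⋀-mono : {f g : I → Carrier} → (∀ i → f i ≤ g i) → ⋀ f ≤ ⋀ g
  ⋀-mono {f = f} {g} f≤g = ⋀-greatest g (⋀ f) (λ i → ≤-trans (⋀-lower f i) (f≤g i))

  ⋁-cong : {f g : I → Carrier} → f ≗ g → ⋁ f ≡ ⋁ g
  ⋁-cong f≗g = antisym (⋁-mono (≤-reflexive ∘ f≗g)) (⋁-mono (≤-reflexive ∘ sym ∘ f≗g))

  ⋀-cong : {f g : I → Carrier} → f ≗ g → ⋀ f ≡ ⋀ g
  ⋀-cong f≗g = antisym (⋀-mono (≤-reflexive ∘ f≗g)) (⋀-mono (≤-reflexive ∘ sym ∘ f≗g))

  ⋁-reindex-≤ : (f : I → Carrier) (g : J → I) → ⋁ (f ∘ g) ≤ ⋁ f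
  ⋁-reindex-≤ f g = ⋁-least (f ∘ g) (⋁ f) (⋁-upper f ∘ g)

  ⋀-reindex-≤ : (f : I → Carrier) (g : J → I) → ⋀ f ≤ ⋀ (f ∘ g)
  ⋀-reindex-≤ f g = ⋀-greatest (f ∘ g) (⋀ f) (⋀-lower f ∘ g)

  *-distribʳ-⋁ : (f : I → Carrier) (a : Carrier) → ⋁ f * a ≡ ⋁ (λ i → f i * a)
  *-distribʳ-⋁ f a = begin-equality
    ⋁ f * a               ≡⟨ comm (⋁ f) a ⟩
    a * ⋁ f               ≡⟨ *-distrib-⋁ a f ⟩
    ⋁ (λ i → a * f i)     ≡⟨ ⋁-cong (λ i → comm a (f i)) ⟩
    ⋁ (λ i → f i * a)     ∎

  ◇⟨_⟩ : (X → Y → Carrier) → L^ L X → L^ L Y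
  ◇⟨_⟩ = _^∃ L

  □⟨_⟩ : (X → Y → Carrier) → L^ L Y → L^ L X
  □⟨_⟩ = _^∀ L

  L-ord-eval : (μ μ′ : L^ L X) (x : X) → L-ord L μ μ′ * μ x ≤ μ′ x
  L-ord-eval μ μ′ x = ⇒-elim (⋀-lower (λ x → μ x ⇒ μ′ x) x)

  L-ord-cong : {μ₁ μ₂ μ₁′ μ₂′ : L^ L X} → μ₁ ≗ μ₂ → μ₁′ ≗ μ₂′ → L-ord L μ₁ μ₁′ ≡ L-ord L μ₂ μ₂′
  L-ord-cong μ₁≗μ₂ μ₁′≗μ₂′ = ⋀-cong (λ x → cong₂ _⇒_ (μ₁≗μ₂ x) (μ₁′≗μ₂′ x))

  □-eval : (φ : X → Y → Carrier) (κ : L^ L Y) (x : X) (y : Y) → □⟨ φ ⟩ κ x * φ x y ≤ κ y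
  □-eval φ κ x y = ⇒-elim (⋀-lower (λ y → φ x y ⇒ κ y) y)

  □◇-extensive : (φ : X → Y → Carrier) (μ : L^ L X) (x : X) → μ x ≤ □⟨ φ ⟩ (◇⟨ φ ⟩ μ) x
  □◇-extensive φ μ x = ⋀-greatest _ _ (λ y → ⇒-intro (⋁-upper (λ x′ → μ x′ * φ x′ y) x))

  ◇-L-monotone : (φ : X → Y → Carrier) (μ μ′ : L^ L X)
               → L-ord L μ μ′ ≤ L-ord L (◇⟨ φ ⟩ μ) (◇⟨ φ ⟩ μ′)
  ◇-L-monotone φ μ μ′ = ⋀-greatest _ _ (λ y → ⇒-intro (begin
    e * ⋁ (λ x → μ x * φ x y)    ≡⟨ *-distrib-⋁ e _ ⟩
    ⋁ (λ x → e * (μ x * φ x y))  ≤⟨ ⋁-mono (λ x → begin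
      e * (μ x * φ x y)            ≡⟨ sym (assoc e (μ x) (φ x y)) ⟩
      e * μ x * φ x y              ≤⟨ *-monoˡ-≤ (φ x y) (L-ord-eval μ μ′ x) ⟩
      μ′ x * φ x y                 ∎) ⟩
    ⋁ (λ x → μ′ x * φ x y)       ∎))
    where e = L-ord L μ μ′

  □-L-monotone : (φ : X → Y → Carrier) (κ κ′ : L^ L Y)
               → L-ord L κ κ′ ≤ L-ord L (□⟨ φ ⟩ κ) (□⟨ φ ⟩ κ′)
  □-L-monotone φ κ κ′ = ⋀-greatest _ _ (λ x → ⇒-intro (⋀-greatest _ _ (λ y → ⇒-intro (begin
    e * □⟨ φ ⟩ κ x * φ x y    ≡⟨ assoc e (□⟨ φ ⟩ κ x) (φ x y) ⟩
    e * (□⟨ φ ⟩ κ x * φ x y)  ≤⟨ *-monoʳ-≤ e (□-eval φ κ x y) ⟩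
    e * κ y                   ≤⟨ L-ord-eval κ κ′ y ⟩
    κ′ y                      ∎))))
    where e = L-ord L κ κ′

  ◇-image : (φ : X → Y → Carrier) (f : X′ → X) (μ : L^ L X′) → ◇⟨ φ ⟩ (_^→ L f μ) ≗ ◇⟨ φ ∘ f ⟩ μ
  ◇-image φ f μ y = antisym
    (⋁-least _ _ (λ x → begin
      ⋁ (λ p → μ (proj₁ p)) * φ x y  ≡⟨ *-distribʳ-⋁ _ (φ x y) ⟩
      ⋁ (λ p → μ (proj₁ p) * φ x y)  ≤⟨ ⋁-least _ _ (λ { (x′ , refl) → ⋁-upper _ x′ }) ⟩
      ◇⟨ φ ∘ f ⟩ μ y                 ∎))
    (begin
      ◇⟨ φ ∘ f ⟩ μ y
        ≤⟨ ⋁-mono (λ x′ → *-monoˡ-≤ (φ (f x′) y) (⋁-upper _ (x′ , refl))) ⟩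
      ⋁ (λ x′ → _^→ L f μ (f x′) * φ (f x′) y)
        ≤⟨ ⋁-reindex-≤ (λ x → _^→ L f μ x * φ x y) f ⟩
      ◇⟨ φ ⟩ (_^→ L f μ) y
        ∎)

  𝒦map≗□◇ : (φ : X → Y → Carrier) (f : X′ → X) (μ : L^ L X′) → 𝒦map L φ f μ ≗ □⟨ φ ⟩ (◇⟨ φ ∘ f ⟩ μ)
  𝒦map≗□◇ φ f μ x = ⋀-cong (λ y → cong (φ x y ⇒_) (◇-image φ f μ y))

  𝒦star∘𝒦map≗id : (φ : X → Y → Carrier) (f : X′ → X) {μ : L^ L X′}
                 → _∈𝒦_ L μ (φ ∘ f) → 𝒦star L f (𝒦map L φ f μ) ≗ μ
  𝒦star∘𝒦map≗id φ f {μ} μ-closed x′ = trans (𝒦map≗□◇ φ f μ (f x′)) (μ-closed x′)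

  𝒦map-isometric : (φ : X → Y → Carrier) (f : X′ → X) (μ μ′ : L^ L X′)
                 → _∈𝒦_ L μ (φ ∘ f) → _∈𝒦_ L μ′ (φ ∘ f)
                 → L-ord L μ μ′ ≡ L-ord L (𝒦map L φ f μ) (𝒦map L φ f μ′)
  𝒦map-isometric φ f μ μ′ μ-closed μ′-closed = antisym
    (begin
      L-ord L μ μ′
        ≤⟨ ◇-L-monotone (φ ∘ f) μ μ′ ⟩
      L-ord L (◇⟨ φ ∘ f ⟩ μ) (◇⟨ φ ∘ f ⟩ μ′)
        ≤⟨ □-L-monotone φ _ _ ⟩
      L-ord L (□⟨ φ ⟩ (◇⟨ φ ∘ f ⟩ μ)) (□⟨ φ ⟩ (◇⟨ φ ∘ f ⟩ μ′))
        ≡⟨ L-ord-cong (sym ∘ 𝒦map≗□◇ φ f μ) (sym ∘ 𝒦map≗□◇ φ f μ′) ⟩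
      L-ord L (𝒦map L φ f μ) (𝒦map L φ f μ′)
        ∎)
    (begin
      L-ord L (𝒦map L φ f μ) (𝒦map L φ f μ′)
        ≤⟨ ⋀-reindex-≤ _ f ⟩
      L-ord L (𝒦star L f (𝒦map L φ f μ)) (𝒦star L f (𝒦map L φ f μ′))
        ≡⟨ L-ord-cong (𝒦star∘𝒦map≗id φ f μ-closed) (𝒦star∘𝒦map≗id φ f μ′-closed) ⟩
      L-ord L μ μ′
        ∎)

  ∈𝒦∘ʳ⇒∈𝒦 : (φ : X → Y → Carrier) (g : Y′ → Y) (μ : L^ L X)
           → _∈𝒦_ L μ (λ x → φ x ∘ g) → _∈𝒦_ L μ φ
  ∈𝒦∘ʳ⇒∈𝒦 φ g μ μ-closed x = antisym
    (begin
      □⟨ φ ⟩ (◇⟨ φ ⟩ μ) x                                    ≤⟨ ⋀-reindex-≤ (λ y → φ x y ⇒ ◇⟨ φ ⟩ μ y) g ⟩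
      □⟨ (λ x → φ x ∘ g) ⟩ (◇⟨ (λ x → φ x ∘ g) ⟩ μ) x        ≡⟨ μ-closed x ⟩
      μ x                                                    ∎)
    (□◇-extensive φ μ x)

  ∈𝒦⇒∈𝒦∘ˡ : (φ : X → Y → Carrier) (f : X′ → X) (μ : L^ L X)
           → _∈𝒦_ L μ φ → _∈𝒦_ L (μ ∘ f) (φ ∘ f)
  ∈𝒦⇒∈𝒦∘ˡ φ f μ μ-closed x′ = antisym
    (begin
      □⟨ φ ∘ f ⟩ (◇⟨ φ ∘ f ⟩ (μ ∘ f)) x′  ≤⟨ ⋀-mono (λ y → ⇒-monoʳ-≤ (φ (f x′) y)
                                               (⋁-reindex-≤ (λ x → μ x * φ x y) f)) ⟩
      □⟨ φ ⟩ (◇⟨ φ ⟩ μ) (f x′)            ≡⟨ μ-closed (f x′) ⟩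
      μ (f x′)                            ∎)
    (□◇-extensive (φ ∘ f) (μ ∘ f) x′)

lemma4p2 : {c ℓ ι : Level} (L : CompleteResiduatedLattice c ℓ ι)
    → let open CompleteResiduatedLattice L in
      {X Y : Set ι} (φ : X → Y → Carrier)
      (P : X → Set ι) (Q : Y → Set ι)
      → IsProp-valued P → IsProp-valued Q
      -- (1) 𝒦φ_{X,Y'} ⊆ 𝒦φ, and 𝒦(1_X,ν)^* is the inclusion map
      → ((∀ (μ : X → Carrier) → _∈𝒦_ L μ (restrictʳ {Q = Q} φ) → _∈𝒦_ L μ φ)
         × (∀ (μ : X → Carrier) → _∈𝒦_ L μ (restrictʳ {Q = Q} φ)
              → ∀ x → 𝒦star L id μ x ≡ μ x))
      -- (2) 𝒦(τ,1_Y) : 𝒦φ_{X',Y} → 𝒦φ is L-isometric, and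
      --     𝒦(τ,1_Y)^* : 𝒦φ → 𝒦φ_{X',Y} is the restriction μ ↦ μ_{X'}
      × ((∀ (μ μ' : Sub X P → Carrier)
            → _∈𝒦_ L μ (restrictˡ {P = P} φ) → _∈𝒦_ L μ' (restrictˡ {P = P} φ)
            → L-ord L μ μ' ≡ L-ord L (𝒦map L φ proj₁ μ) (𝒦map L φ proj₁ μ'))
         × (∀ (μ : X → Carrier) → _∈𝒦_ L μ φ
              → _∈𝒦_ L (𝒦star L proj₁ μ) (restrictˡ {P = P} φ)
                × (∀ (x' : Sub X P) → 𝒦star L proj₁ μ x' ≡ μ (proj₁ x'))))
lemma4p2 L φ P Q _ _ =
  (∈𝒦∘ʳ⇒∈𝒦 L φ proj₁ , λ _ _ _ → refl)
  , (𝒦map-isometric L φ proj₁ , λ μ μ-closed → ∈𝒦⇒∈𝒦∘ˡ L φ proj₁ μ μ-closed , λ _ → refl)
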